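{- Let $X\in\{K,D,T,B,S4,S5\}$. For every set $\Phi\subseteq\mathcal{L}^{\cap}$ and every $\phi\in\mathcal{L}^{\cap}$: if $\Phi\models_X\phi$, then $\Phi\vdash_{\Lambda_X^{\cap}}\phi$.
   Context: Fix a countably infinite set $P$ of propositional variables and an at most countable set $\mathbb{I}$ of primitive types. An index is a finite nonempty subset of $\mathbb{I}$. The language $\mathcal{L}^{\cap}$ is given by $\phi ::= p \mid \neg\phi \mid (\phi\to\phi) \mid \Box_i\phi \mid [\cap_I]\phi$ with $p\in P$, $i\in\mathbb{I}$, $I$ an index. A Kripke model is $M=(S,R,V)$ with $S\neq\emptyset$, $R$ assigning to each $i\in\mathbb{I}$ a binary relation $R_i$ on $S$, $V:P\to\wp(S)$. Truth: $M,s\models p$ iff $s\in V(p)$; Boolean clauses as usual; $M,s\models\Box_i\phi$ iff $M,t\models\phi$ for all $t$ with $(s,t)\in R_i$; $M,s\models[\cap_I]\phi$ iff $M,t\models\phi$ for all $t$ with $(s,t)\in\bigcap_{i\in I}R_i$. The class $\mathcal{C}_K$ consists of all Kripke models; $\mathcal{C}_D$ (resp. $\mathcal{C}_T,\mathcal{C}_B,\mathcal{C}_{S4},\mathcal{C}_{S5}$) of all models in which every $R_i$ is serial (resp. reflexive; reflexive and symmetric; reflexive and transitive; an equivalence relation). $\Phi\models_X\phi$ means: for every model $M\in\mathcal{C}_X$ and state $s$, if $M,s\models\psi$ for all $\psi\in\Phi$ then $M,s\models\phi$. Axiomatizations (all schemes instantiated over $\mathcal{L}^{\cap}$, for all $i\in\mathbb{I}$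 and all indices $I,J$): $\Lambda_K^{\cap}$ consists of all propositional tautologies, modus ponens, (K) $\Box_i(\phi\to\psi)\to(\Box_i\phi\to\Box_i\psi)$, (N) from $\phi$ infer $\Box_i\phi$, (K$\cap$) $[\cap_I](\phi\to\psi)\to([\cap_I]\phi\to[\cap_I]\psi)$, (N$\cap$) from $\phi$ infer $[\cap_I]\phi$, ($\cap$1) $\Box_i\phi\leftrightarrow[\cap_{\{i\}}]\phi$, ($\cap$2) $[\cap_I]\phi\to[\cap_J]\phi$ whenever $I\subseteq J$. Further: $\Lambda_D^{\cap}=\Lambda_K^{\cap}+$(D) $\Box_i\phi\to\neg\Box_i\neg\phi$; $\Lambda_T^{\cap}=\Lambda_K^{\cap}+$(T) $\Box_i\phi\to\phi$ $+$(T$\cap$) $[\cap_I]\phi\to\phi$; $\Lambda_B^{\cap}=\Lambda_T^{\cap}+$(B) $\neg\phi\to\Box_i\neg\Box_i\phi$ $+$(B$\cap$) $\neg\phi\to[\cap_I]\neg[\cap_I]\phi$; $\Lambda_{S4}^{\cap}=\Lambda_T^{\cap}+$(4) $\Box_i\phi\to\Box_i\Box_i\phi$ $+$(4$\cap$) $[\cap_I]\phi\to[\cap_I][\cap_I]\phi$; $\Lambda_{S5}^{\cap}=\Lambda_T^{\cap}+$(5) $\neg\Box_i\phi\to\Box_i\neg\Box_i\phi$ $+$(5$\cap$) $\neg[\cap_I]\phi\to[\cap_I]\neg[\cap_I]\phi$. $\Phi\vdash_{\Lambda}\phi$ means $\phi$ is derivable in $\Lambda$ from finitely many premises in $\Phi$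 (i.e. $(\psi_1\wedge\dots\wedge\psi_n)\to\phi$ is a theorem of $\Lambda$ for some $\psi_1,\ldots,\psi_n\in\Phi$). -}

module Defs where

open import Level using (0ℓ)
open import Data.Nat using (ℕ; _<_)
open import Data.Bool using (Bool; true; false; not; _∧_; _∨_)
open import Data.List using (List; []; _∷_)
open import Data.List.Membership.Propositional using (_∈_)
open import Data.List.Relation.Unary.All using (All)
open import Data.List.Relation.Unary.AllPairs using (AllPairs)
open import Data.Product using (Σ; ∃; _×_; _,_)
open import Data.Sum using (_⊎_)
open import Data.Empty using (⊥)
open import Data.Unit using (⊤)
open import Data.List.Relation.Unary.AllPairs using ([]; _∷_)
open import Data.List.Relation.Unary.All using ([])
open import Relation.Nullary using (¬_)
open import Relation.Binary.PropositionalEquality using (_≡_)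
open import Relation.Binary.Definitions using (Reflexive; Symmetric; Transitive)
open import Function.Definitions using (Injective)

-- Primitive types: an at most countable set 𝕀, given as a type with an
-- injection into ℕ.  Propositional variables: P = ℕ (countably infinite).

record PrimTypes : Set₁ where
  field
    Ty     : Set
    enc    : Ty → ℕ
    enc-inj : Injective _≡_ _≡_ enc

data Sys : Set where
  K D T B S4 S5 : Sys

Serial : {A : Set} → (A → A → Set) → Set
Serial {A} r = ∀ (x : A) → ∃ λ y → r x y

FrameCond : Sys → {A : Set} → (A → A → Set) → Set
FrameCond K  r = ⊤
FrameCond D  r = Serial r
FrameCond T  r = Reflexive r
FrameCond B  r = Reflexive r × Symmetric r
FrameCond S4 r = Reflexive r × Transitive r
FrameCond S5 r = Reflexive r × Symmetric r × Transitive r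

module _ (𝕋 : PrimTypes) where
  open PrimTypes 𝕋

  -- An index: a finite nonempty subset of 𝕀, represented canonically as a
  -- nonempty list strictly increasing w.r.t. enc (so each finite nonempty
  -- subset has exactly one representation, up to proofs of _<_).
  record Index : Set where
    constructor index
    field
      hd     : Ty
      tl     : List Ty
      sorted : AllPairs (λ a b → enc a < enc b) (hd ∷ tl)

  _∈ᴵ_ : Ty → Index → Set
  i ∈ᴵ I = i ∈ (Index.hd I ∷ Index.tl I)

  ⟨_⟩ : Ty → Index
  ⟨ i ⟩ = index i [] ([] ∷ [])

  _⊆ᴵ_ : Index → Index → Set
  I ⊆ᴵ J = ∀ i → i ∈ᴵ I → i ∈ᴵ J

  infixr 5 _⇒_
  data Fm : Set where
    var  : ℕ → Fm
    ¬'   : Fm → Fm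
    _⇒_  : Fm → Fm → Fm
    □    : Ty → Fm → Fm
    [∩_] : Index → Fm → Fm

  _∧ᶠ_ : Fm → Fm → Fm
  a ∧ᶠ b = ¬' (a ⇒ ¬' b)

  _⇔_ : Fm → Fm → Fm
  φ ⇔ ψ = (φ ⇒ ψ) ∧ᶠ (ψ ⇒ φ)

  record Model : Set₁ where
    field
      S : Set
      s₀ : S          -- S ≠ ∅
      R : Ty → S → S → Set
      V : ℕ → S → Set

  module _ (M : Model) where
    open Model M

    Rᴵ : Index → S → S → Set
    Rᴵ I s t = ∀ i → i ∈ᴵ I → R i s t

    _⊨_ : S → Fm → Set
    s ⊨ var p   = V p s
    s ⊨ ¬' φ    = ¬ (s ⊨ φ)
    s ⊨ (φ ⇒ ψ) = s ⊨ φ → s ⊨ ψ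
    s ⊨ □ i φ   = ∀ t → R i s t → t ⊨ φ
    s ⊨ [∩ I ] φ = ∀ t → Rᴵ I s t → t ⊨ φ

  InClass : Sys → Model → Set
  InClass X M = ∀ i → FrameCond X (Model.R M i)

  SemConseq : Sys → (Fm → Set) → Fm → Set₁
  SemConseq X Φ φ =
    ∀ (M : Model) → InClass X M → ∀ (s : Model.S M) →
    (∀ ψ → Φ ψ → _⊨_ M s ψ) → _⊨_ M s φ

  -- Propositional tautologies: formulas true under every Boolean
  -- assignment to their maximal non-Boolean subformulas.

  evalB : (Fm → Bool) → Fm → Bool
  evalB v (var p)    = v (var p)
  evalB v (¬' φ)     = not (evalB v φ)
  evalB v (φ ⇒ ψ)    = not (evalB v φ) ∨ evalB v ψ
  evalB v (□ i φ)    = v (□ i φ)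
  evalB v ([∩ I ] φ) = v ([∩ I ] φ)

  Tautology : Fm → Set
  Tautology φ = ∀ (v : Fm → Bool) → evalB v φ ≡ true

  HasT : Sys → Set
  HasT K  = ⊥
  HasT D  = ⊥
  HasT T  = ⊤
  HasT B  = ⊤
  HasT S4 = ⊤
  HasT S5 = ⊤

  data Extra : Sys → Fm → Set where
    axD   : ∀ {i φ} → Extra D (□ i φ ⇒ ¬' (□ i (¬' φ)))
    axT   : ∀ {X i φ} → HasT X → Extra X (□ i φ ⇒ φ)
    axT∩  : ∀ {X I φ} → HasT X → Extra X ([∩ I ] φ ⇒ φ)
    axB   : ∀ {i φ} → Extra B (¬' φ ⇒ □ i (¬' (□ i φ)))
    axB∩  : ∀ {I φ} → Extra B (¬' φ ⇒ [∩ I ] (¬' ([∩ I ] φ)))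
    ax4   : ∀ {i φ} → Extra S4 (□ i φ ⇒ □ i (□ i φ))
    ax4∩  : ∀ {I φ} → Extra S4 ([∩ I ] φ ⇒ [∩ I ] ([∩ I ] φ))
    ax5   : ∀ {i φ} → Extra S5 (¬' (□ i φ) ⇒ □ i (¬' (□ i φ)))
    ax5∩  : ∀ {I φ} → Extra S5 (¬' ([∩ I ] φ) ⇒ [∩ I ] (¬' ([∩ I ] φ)))

  data ⊢_∶_ (X : Sys) : Fm → Set where
    taut  : ∀ {φ} → Tautology φ → ⊢ X ∶ φ
    mp    : ∀ {φ ψ} → ⊢ X ∶ (φ ⇒ ψ) → ⊢ X ∶ φ → ⊢ X ∶ ψ
    axK   : ∀ {i φ ψ} → ⊢ X ∶ (□ i (φ ⇒ ψ) ⇒ (□ i φ ⇒ □ i ψ))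
    nec   : ∀ {i φ} → ⊢ X ∶ φ → ⊢ X ∶ □ i φ
    axK∩  : ∀ {I φ ψ} → ⊢ X ∶ ([∩ I ] (φ ⇒ ψ) ⇒ ([∩ I ] φ ⇒ [∩ I ] ψ))
    nec∩  : ∀ {I φ} → ⊢ X ∶ φ → ⊢ X ∶ [∩ I ] φ
    ax∩1  : ∀ {i φ} → ⊢ X ∶ (□ i φ ⇔ [∩ ⟨ i ⟩ ] φ)
    ax∩2  : ∀ {I J φ} → I ⊆ᴵ J → ⊢ X ∶ ([∩ I ] φ ⇒ [∩ J ] φ)
    extra : ∀ {φ} → Extra X φ → ⊢ X ∶ φ

  ⋀ : Fm → List Fm → Fm
  ⋀ ψ []        = ψ
  ⋀ ψ (ψ' ∷ ψs) = ψ ∧ᶠ ⋀ ψ' ψs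

  Derives : Sys → (Fm → Set) → Fm → Set
  Derives X Φ φ =
    (⊢ X ∶ φ) ⊎
    (Σ Fm λ ψ → Σ (List Fm) λ ψs → All Φ (ψ ∷ ψs) × ⊢ X ∶ (⋀ ψ ψs ⇒ φ))

-- If Φ ⊬ φ, then Φ ∪ {¬φ} is consistent and (by excluded middle and an
-- injective coding of formulas by numbers) extends to a maximal consistent set w₀.  The canonical
-- relation R_I of [∩ I] need not be the intersection of the R_{i}, i ∈ I, so the model is unravelled:
-- states are paths from w₀ whose steps are R_J-successors labelled by J, and i relates two paths when
-- one is reached from the other along steps labelled by indices containing i, by a walk of a shape
-- that makes the relation satisfy the frame conditions of X.  Two walks between the same nodes are
-- nested, so paths related by every i ∈ I are joined by a walk whose labels all contain I; the
-- canonical properties of R_I given by T∩, B∩, 4∩, 5∩ then collapse such a walk to one R_I-step,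
-- which is exactly what the truth lemma for [∩ I] needs.
module Submission where

open import Level using (0ℓ)
open import Axiom.ExcludedMiddle using (ExcludedMiddle)
open import Data.Bool using (Bool; true; false; not; _∨_) renaming (_∧_ to _&&_; T to True)
open import Data.Bool.Properties using (T-∧; T-≡)
open import Data.Empty using (⊥; ⊥-elim)
open import Data.Unit using (⊤; tt)
open import Data.Fin using (Fin; zero; suc)
open import Data.List using (List; []; _∷_; _++_; [_]; map)
open import Data.List.Properties using (∷-injective; map-injective; ++-assoc; ++-cancelʳ)
open import Data.List.Relation.Unary.All using (All; []; _∷_)
import Data.List.Relation.Unary.All as All
open import Data.List.Membership.Propositional using (_∈_)
open import Data.List.Relation.Unary.Any using (here; there)
import Data.List.Relation.Unary.AllPairs as AllPairs
open import Data.List.Relation.Unary.All.Properties using (++⁺; ++⁻ˡ; ++⁻ʳ)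
open import Data.Nat using (ℕ; zero; suc; _+_; _⊔_; _≤′_; ≤′-refl; ≤′-step)
open import Data.Nat.Properties using (m≤m⊔n; m≤n⊔m; ≤⇒≤′; +-suc; +-identityʳ; suc-injective; <-irrelevant)
open import Data.Product using (Σ; ∃; _×_; _,_; proj₁; proj₂; swap)
open import Data.Sum using (_⊎_; inj₁; inj₂)
import Data.Sum as Sum
open import Data.Vec using (Vec; []; _∷_; lookup)
import Data.Vec as Vec
open import Data.Vec.Properties using (lookup-map)
open import Function using (id; _∘_)
open import Function.Bundles using (Equivalence; _⇔_; mk⇔)
open import Function.Properties.Equivalence using () renaming (sym to ⇔-sym; trans to ⇔-trans)
open import Relation.Nullary using (¬_; Dec; yes; no)
open import Relation.Nullary.Decidable using (isYes; toWitness; fromWitness; decidable-stable)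
open import Relation.Unary using (_∩_)
open import Relation.Binary.Definitions using (Reflexive; Symmetric; Transitive)
open import Relation.Binary.PropositionalEquality using (_≡_; refl; sym; trans; cong; cong₂; subst)

open import Defs hiding (_⇔_) renaming (⟨_⟩ to singleton)

valid : (n : ℕ) → (Vec Bool n → Bool) → Bool
valid zero    f = f []
valid (suc n) f = valid n (λ v → f (true ∷ v)) && valid n (λ v → f (false ∷ v))

valid-sound : ∀ n (f : Vec Bool n → Bool) → True (valid n f) → ∀ v → True (f v)
valid-sound zero    f ok []          = ok
valid-sound (suc n) f ok (true ∷ v)  = valid-sound n _ (proj₁ (Equivalence.to T-∧ ok)) v
valid-sound (suc n) f ok (false ∷ v) = valid-sound n _ (proj₂ (Equivalence.to T-∧ ok)) v

diagonalStep : ℕ × ℕ → ℕ × ℕ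
diagonalStep (zero  , b) = suc b , 0
diagonalStep (suc a , b) = a , suc b

unpair : ℕ → ℕ × ℕ
unpair zero    = 0 , 0
unpair (suc n) = diagonalStep (unpair n)

Enumerated : ℕ × ℕ → Set
Enumerated x = ∃ λ n → unpair n ≡ x

enumerated-step : ∀ {x} → Enumerated x → Enumerated (diagonalStep x)
enumerated-step (n , e) = suc n , cong diagonalStep e

enumerated-along : ∀ k a b → Enumerated (k + a , b) → Enumerated (a , k + b)
enumerated-along zero    a b e = e
enumerated-along (suc k) a b e =
  subst (λ c → Enumerated (a , c)) (+-suc k b) (enumerated-along k a (suc b) (enumerated-step e))

enumerated-diagonal : ∀ s → Enumerated (s , 0)
enumerated-diagonal zero    = 0 , refl
enumerated-diagonal (suc s) = enumerated-step (subst (λ c → Enumerated (0 , c)) (+-identityʳ s)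
  (enumerated-along s 0 0 (subst (λ c → Enumerated (c , 0)) (sym (+-identityʳ s)) (enumerated-diagonal s))))

unpair-surjective : ∀ x → Enumerated x
unpair-surjective (a , b) = subst (λ c → Enumerated (a , c)) (+-identityʳ b)
  (enumerated-along b a 0 (enumerated-diagonal (b + a)))

-- Opaque, so that unification never unfolds pair into the proof term that computes it.
opaque
  pair : ℕ → ℕ → ℕ
  pair a b = proj₁ (unpair-surjective (a , b))

  pair-injective : ∀ {a b c d} → pair a b ≡ pair c d → a ≡ c × b ≡ d
  pair-injective {a} {b} {c} {d} e
    with trans (sym (proj₂ (unpair-surjective (a , b))))
               (trans (cong unpair e) (proj₂ (unpair-surjective (c , d))))
  ... | refl = refl , refl

codeList : List ℕ → ℕ
codeList []       = 0
codeList (x ∷ xs) = suc (pair x (codeList xs))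

codeList-injective : ∀ xs ys → codeList xs ≡ codeList ys → xs ≡ ys
codeList-injective []       []       e = refl
codeList-injective (x ∷ xs) (y ∷ ys) e with pair-injective (suc-injective e)
... | x≡y , e′ = cong₂ _∷_ x≡y (codeList-injective xs ys e′)

Euclidean : {A : Set} → (A → A → Set) → Set
Euclidean r = ∀ {x y z} → r x y → r x z → r y z

module _ {A : Set} {r : A → A → Set} (refl-r : Reflexive r) (eucl : Euclidean r) where

  euclidean⇒symmetric : Symmetric r
  euclidean⇒symmetric rxy = eucl rxy refl-r

  euclidean⇒transitive : Transitive r
  euclidean⇒transitive rxy ryz = eucl (euclidean⇒symmetric rxy) ryz

++-levi : {A : Set} (a c a′ d : List A) → a ++ c ≡ a′ ++ d →
          (∃ λ x → c ≡ x ++ d × a′ ≡ a ++ x) ⊎ (∃ λ x → d ≡ x ++ c × a ≡ a′ ++ x)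
++-levi []      c a′       d e = inj₁ (a′ , e , refl)
++-levi (y ∷ a) c []       d e = inj₂ (y ∷ a , sym e , refl)
++-levi (y ∷ a) c (y′ ∷ a′) d e with ∷-injective e
... | refl , e′ with ++-levi a c a′ d e′
... | inj₁ (x , c≡ , a′≡) = inj₁ (x , c≡ , cong (y ∷_) a′≡)
... | inj₂ (x , d≡ , a≡)  = inj₂ (x , d≡ , cong (y ∷_) a≡)

IsSingleton AtMostOne : {A : Set} → List A → Set
IsSingleton []          = ⊥
IsSingleton (_ ∷ [])    = ⊤
IsSingleton (_ ∷ _ ∷ _) = ⊥
AtMostOne []          = ⊤
AtMostOne (_ ∷ [])    = ⊤
AtMostOne (_ ∷ _ ∷ _) = ⊥

-- Two nodes π = up ++ base and π′ = down ++ base of a tree (paths listed leaf first) are joined when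
-- π′ is reached from π by climbing the steps up to their common ancestor base and descending
-- the steps down.  Shape Y says which such walks the frame conditions of Y force into the relation.
Shape : {A : Set} → Sys → List A → List A → Set
Shape K  up down = up ≡ [] × IsSingleton down
Shape D  up down = up ≡ [] × IsSingleton down
Shape T  up down = up ≡ [] × AtMostOne down
Shape B  up down = (up ≡ [] × AtMostOne down) ⊎ (AtMostOne up × down ≡ [])
Shape S4 up down = up ≡ []
Shape S5 up down = ⊤

Shape-step : {A : Set} (Y : Sys) {x : A} → Shape Y [] [ x ]
Shape-step K  = refl , _
Shape-step D  = refl , _
Shape-step T  = refl , _
Shape-step B  = inj₁ (refl , _)
Shape-step S4 = refl
Shape-step S5 = _

Shape-swap-B : {A : Set} {up down : List A} → Shape B up down → Shape B down up
Shape-swap-B (inj₁ (up≡ , down≤1)) = inj₂ (down≤1 , up≡)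
Shape-swap-B (inj₂ (up≤1 , down≡)) = inj₁ (down≡ , up≤1)

record Joined {A : Set} (Y : Sys) (P : A → Set) (π π′ : List A) : Set where
  constructor joined
  field
    up down base : List A
    π≡     : π ≡ up ++ base
    π′≡    : π′ ≡ down ++ base
    up-P   : All P up
    down-P : All P down
    shape  : Shape Y up down

module _ {A : Set} {Y : Sys} where

  Joined-map : ∀ {P Q : A → Set} {π π′} → (∀ {x} → P x → Q x) → Joined Y P π π′ → Joined Y Q π π′
  Joined-map f (joined up down base π≡ π′≡ pu pd sh) =
    joined up down base π≡ π′≡ (All.map f pu) (All.map f pd) sh

  Joined-step : ∀ {P : A → Set} {x} π → P x → Joined Y P π (x ∷ π)
  Joined-step π p = joined [] [ _ ] π refl refl [] (p ∷ []) (Shape-step Y)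

  Joined-refl : ∀ {P : A → Set} → Shape Y [] [] → Reflexive (Joined Y P)
  Joined-refl sh {π} = joined [] [] π refl refl [] [] sh

  Joined-swap : ∀ {P : A → Set} → (∀ {up down : List A} → Shape Y up down → Shape Y down up) →
                Symmetric (Joined Y P)
  Joined-swap swap (joined up down base π≡ π′≡ pu pd sh) = joined down up base π′≡ π≡ pd pu (swap sh)

  private
    Joined-∩-longer : ∀ {P Q : A → Set} {π π′} (r : Joined Y P π π′) (r′ : Joined Y Q π π′) x →
      Joined.base r ≡ x ++ Joined.base r′ → Joined.up r′ ≡ Joined.up r ++ x → Joined Y (P ∩ Q) π π′
    Joined-∩-longer (joined up down base π≡ π′≡ pu pd sh) (joined up′ down′ base′ _ π′≡′ pu′ pd′ _) x base≡ up′≡ =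
      joined up down base π≡ π′≡
        (All.zip (pu , ++⁻ˡ up (subst (All _) up′≡ pu′)))
        (All.zip (pd , ++⁻ˡ down (subst (All _) down′≡ pd′))) sh
      where
      down′≡ : down′ ≡ down ++ x
      down′≡ = ++-cancelʳ base′ down′ (down ++ x)
        (trans (sym π′≡′) (trans π′≡ (trans (cong (down ++_) base≡) (sym (++-assoc down x base′)))))

  -- Of two walks between the same nodes, the one turning nearer the root contains all steps of the other.
  Joined-∩ : ∀ {P Q : A → Set} {π π′} → Joined Y P π π′ → Joined Y Q π π′ → Joined Y (P ∩ Q) π π′
  Joined-∩ r r′ with ++-levi (Joined.up r) (Joined.base r) (Joined.up r′) (Joined.base r′)
                             (trans (sym (Joined.π≡ r)) (Joined.π≡ r′))
  ... | inj₁ (x , base≡ , up′≡) = Joined-∩-longer r r′ x base≡ up′≡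
  ... | inj₂ (x , base′≡ , up≡) = Joined-map swap (Joined-∩-longer r′ r x base′≡ up≡)

  Joined-⋂ : ∀ {B : Set} (Q : B → A → Set) b bs {π π′} → (∀ c → c ∈ b ∷ bs → Joined Y (Q c) π π′) →
             Joined Y (λ a → All (λ c → Q c a) (b ∷ bs)) π π′
  Joined-⋂ Q b []        r = Joined-map (_∷ []) (r b (here refl))
  Joined-⋂ Q b (b′ ∷ bs) r =
    Joined-map (λ (q , qs) → q ∷ qs) (Joined-∩ (r b (here refl)) (Joined-⋂ Q b′ bs (λ c m → r c (there m))))

module _ {A : Set} {P : A → Set} where

  Joined-trans-S4 : Transitive (Joined S4 P)
  Joined-trans-S4 (joined [] down base refl refl [] pd refl) (joined [] down′ _ refl refl [] pd′ refl) =
    joined [] (down′ ++ down) base refl (sym (++-assoc down′ down base)) [] (++⁺ pd′ pd) refl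

  Joined-trans-S5 : Transitive (Joined S5 P)
  Joined-trans-S5 (joined up down base refl π′≡ pu pd _) (joined up′ down′ base′ π′≡′ refl pu′ pd′ _)
    with ++-levi down base up′ base′ (trans (sym π′≡) π′≡′)
  ... | inj₁ (x , base≡ , up′≡) =
    joined (up ++ x) down′ base′ (trans (cong (up ++_) base≡) (sym (++-assoc up x base′))) refl
           (++⁺ pu (++⁻ʳ down (subst (All _) up′≡ pu′))) pd′ _
  ... | inj₂ (x , base′≡ , down≡) =
    joined up (down′ ++ x) base refl (trans (cong (down′ ++_) base′≡) (sym (++-assoc down′ x base)))
           pu (++⁺ pd′ (++⁻ʳ up′ (subst (All _) down≡ pd))) _

-- The frame conditions that Shape Y builds into the unravelled relation; seriality is instead
-- obtained by adding successors.
ClosureCond : Sys → {A : Set} → (A → A → Set) → Set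
ClosureCond D r = ⊤
ClosureCond Y r = FrameCond Y r

module Completeness (𝕋 : PrimTypes) where
  open PrimTypes 𝕋

  Formula : Set
  Formula = Fm 𝕋

  infixr 6 _∧_
  _∧_ : Formula → Formula → Formula
  _∧_ = _∧ᶠ_ 𝕋

  ⟨_⟩ : Ty → Index 𝕋
  ⟨_⟩ = singleton 𝕋

  ⊤ᶠ ⊥ᶠ : Formula
  ⊤ᶠ = var 0 ⇒ var 0
  ⊥ᶠ = ¬' ⊤ᶠ

  infixr 5 _⟶_
  infixr 6 _&_
  infix 7 ~_
  data Schema (n : ℕ) : Set where
    ‵_   : Fin n → Schema n
    ~_   : Schema n → Schema n
    _⟶_ : Schema n → Schema n → Schema n

  _&_ : ∀ {n} → Schema n → Schema n → Schema n
  s & t = ~ (s ⟶ ~ t)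

  pattern α = ‵ zero
  pattern β = ‵ suc zero
  pattern γ = ‵ suc (suc zero)
  pattern δ = ‵ suc (suc (suc zero))
  pattern ε = ‵ suc (suc (suc (suc zero)))

  _⟪_⟫ : ∀ {n} → Schema n → Vec Formula n → Formula
  (‵ x)   ⟪ ρ ⟫ = lookup ρ x
  (~ s)   ⟪ ρ ⟫ = ¬' (s ⟪ ρ ⟫)
  (s ⟶ t) ⟪ ρ ⟫ = s ⟪ ρ ⟫ ⇒ t ⟪ ρ ⟫

  ⟦_⟧ : ∀ {n} → Schema n → Vec Bool n → Bool
  ⟦ ‵ x ⟧   v = lookup v x
  ⟦ ~ s ⟧   v = not (⟦ s ⟧ v)
  ⟦ s ⟶ t ⟧ v = not (⟦ s ⟧ v) ∨ ⟦ t ⟧ v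

  evalB-⟪⟫ : ∀ {n} v (s : Schema n) ρ → evalB 𝕋 v (s ⟪ ρ ⟫) ≡ ⟦ s ⟧ (Vec.map (evalB 𝕋 v) ρ)
  evalB-⟪⟫ v (‵ x)   ρ = sym (lookup-map x (evalB 𝕋 v) ρ)
  evalB-⟪⟫ v (~ s)   ρ = cong not (evalB-⟪⟫ v s ρ)
  evalB-⟪⟫ v (s ⟶ t) ρ = cong₂ (λ a b → not a ∨ b) (evalB-⟪⟫ v s ρ) (evalB-⟪⟫ v t ρ)

  codeIndex : Index 𝕋 → ℕ
  codeIndex (index i is _) = codeList (map enc (i ∷ is))

  codeIndex-injective : ∀ I J → codeIndex I ≡ codeIndex J → I ≡ J
  codeIndex-injective (index i is s) (index j js s′) e
    with map-injective enc-inj {i ∷ is} {j ∷ js} (codeList-injective _ _ e)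
  ... | refl = cong (index i is) (AllPairs.irrelevant <-irrelevant s s′)

  tag body code : Formula → ℕ
  tag (var _)     = 0
  tag (¬' _)      = 1
  tag (_ ⇒ _)     = 2
  tag (□ _ _)     = 3
  tag ([∩ _ ] _)  = 4
  body (var p)    = p
  body (¬' φ)     = code φ
  body (φ ⇒ ψ)    = pair (code φ) (code ψ)
  body (□ i φ)    = pair (enc i) (code φ)
  body ([∩ I ] φ) = pair (codeIndex I) (code φ)
  code φ = pair (tag φ) (body φ)

  code-injective : ∀ φ ψ → code φ ≡ code ψ → φ ≡ ψ
  body-injective : ∀ φ ψ → tag φ ≡ tag ψ → body φ ≡ body ψ → φ ≡ ψ
  code-injective φ ψ e = body-injective φ ψ (proj₁ (pair-injective e)) (proj₂ (pair-injective e))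
  body-injective (var p)    (var q)    refl e = cong var e
  body-injective (¬' φ)     (¬' ψ)     refl e = cong ¬' (code-injective φ ψ e)
  body-injective (φ ⇒ φ′)   (ψ ⇒ ψ′)   refl e =
    cong₂ _⇒_ (code-injective φ ψ (proj₁ (pair-injective e))) (code-injective φ′ ψ′ (proj₂ (pair-injective e)))
  body-injective (□ i φ)    (□ j ψ)    refl e =
    cong₂ □ (enc-inj (proj₁ (pair-injective e))) (code-injective φ ψ (proj₂ (pair-injective e)))
  body-injective ([∩ I ] φ) ([∩ J ] ψ) refl e =
    cong₂ [∩_] (codeIndex-injective I J (proj₁ (pair-injective e))) (code-injective φ ψ (proj₂ (pair-injective e)))

  ⊨-□ : (M : Model 𝕋) {s : Model.S M} {i : Ty} {φ : Formula} →
        _⊨_ 𝕋 M s (□ i φ) ⇔ _⊨_ 𝕋 M s ([∩ ⟨ i ⟩ ] φ)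
  ⊨-□ M = mk⇔ (λ h t r → h t (r _ (here refl))) (λ h t r → h t λ { _ (here refl) → r })

  module Hilbert (X : Sys) where

    infix 3 ⊢_ _⊩_
    infixl 4 _⊕_

    ⊢_ : Formula → Set
    ⊢ φ = ⊢_∶_ 𝕋 X φ

    -- For a valid schema s the hidden argument has type ⊤, so it is inferred.
    tautology : ∀ {n} (s : Schema n) {_ : True (valid n ⟦ s ⟧)} (ρ : Vec Formula n) → ⊢ s ⟪ ρ ⟫
    tautology s {ok} ρ = taut λ v →
      trans (evalB-⟪⟫ v s ρ) (Equivalence.to T-≡ (valid-sound _ ⟦ s ⟧ ok _))

    data _⊩_ (Γ : Formula → Set) : Formula → Set where
      hyp : ∀ {φ} → Γ φ → Γ ⊩ φ
      thm : ∀ {φ} → ⊢ φ → Γ ⊩ φ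
      mp  : ∀ {φ ψ} → Γ ⊩ φ ⇒ ψ → Γ ⊩ φ → Γ ⊩ ψ

    ⊩-mono : ∀ {Γ Δ : Formula → Set} → (∀ {ψ} → Γ ψ → Δ ψ) → ∀ {φ} → Γ ⊩ φ → Δ ⊩ φ
    ⊩-mono Γ⊆Δ (hyp g)   = hyp (Γ⊆Δ g)
    ⊩-mono Γ⊆Δ (thm t)   = thm t
    ⊩-mono Γ⊆Δ (mp d e) = mp (⊩-mono Γ⊆Δ d) (⊩-mono Γ⊆Δ e)

    _⊕_ : (Formula → Set) → Formula → Formula → Set
    (Γ ⊕ φ) ψ = Γ ψ ⊎ ψ ≡ φ

    deduction : ∀ {Γ φ ψ} → Γ ⊕ φ ⊩ ψ → Γ ⊩ φ ⇒ ψ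
    deduction {φ = φ} (hyp (inj₁ g))    = mp (thm (tautology (α ⟶ β ⟶ α) (_ ∷ φ ∷ []))) (hyp g)
    deduction {φ = φ} (hyp (inj₂ refl)) = thm (tautology (α ⟶ α) (φ ∷ []))
    deduction {φ = φ} (thm t)           = thm (mp (tautology (α ⟶ β ⟶ α) (_ ∷ φ ∷ [])) t)
    deduction {φ = φ} (mp {a} {b} d e)  =
      mp (mp (thm (tautology ((γ ⟶ α ⟶ β) ⟶ (γ ⟶ α) ⟶ γ ⟶ β) (a ∷ b ∷ φ ∷ []))) (deduction d)) (deduction e)

    Consistent : (Formula → Set) → Set
    Consistent Γ = ¬ (Γ ⊩ ⊥ᶠ)

    by-contradiction : ∀ {Γ φ} → Γ ⊕ ¬' φ ⊩ ⊥ᶠ → Γ ⊩ φ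
    by-contradiction {φ = φ} d =
      mp (thm (tautology ((~ α ⟶ ~ (β ⟶ β)) ⟶ α) (φ ∷ var 0 ∷ []))) (deduction d)

    ⋀-++ : ∀ ψ ψs χ χs → ⊢ ⋀ 𝕋 ψ (ψs ++ χ ∷ χs) ⇒ ⋀ 𝕋 ψ ψs ∧ ⋀ 𝕋 χ χs
    ⋀-++ ψ []         χ χs = tautology (α ⟶ α) (_ ∷ [])
    ⋀-++ ψ (ψ′ ∷ ψs) χ χs =
      mp (tautology ((β ⟶ γ & δ) ⟶ α & β ⟶ (α & γ) & δ)
                    (ψ ∷ ⋀ 𝕋 ψ′ (ψs ++ χ ∷ χs) ∷ ⋀ 𝕋 ψ′ ψs ∷ ⋀ 𝕋 χ χs ∷ []))
         (⋀-++ ψ′ ψs χ χs)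

    Derives-mp : ∀ {Γ φ ψ} → Derives 𝕋 X Γ (φ ⇒ ψ) → Derives 𝕋 X Γ φ → Derives 𝕋 X Γ ψ
    Derives-mp (inj₁ t) (inj₁ u) = inj₁ (mp t u)
    Derives-mp {φ = φ} {ψ} (inj₁ t) (inj₂ (χ , χs , g , u)) =
      inj₂ (χ , χs , g , mp (mp (tautology ((α ⟶ β) ⟶ (β ⟶ γ) ⟶ α ⟶ γ) (⋀ 𝕋 χ χs ∷ φ ∷ ψ ∷ [])) u) t)
    Derives-mp {φ = φ} {ψ} (inj₂ (χ , χs , g , t)) (inj₁ u) =
      inj₂ (χ , χs , g , mp (mp (tautology ((α ⟶ β ⟶ γ) ⟶ β ⟶ α ⟶ γ) (⋀ 𝕋 χ χs ∷ φ ∷ ψ ∷ [])) t) u)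
    Derives-mp {φ = φ} {ψ} (inj₂ (χ , χs , g , t)) (inj₂ (χ′ , χs′ , g′ , u)) =
      inj₂ (χ , χs ++ χ′ ∷ χs′ , ++⁺ g g′ ,
            mp (mp (mp (tautology ((ε ⟶ α & β) ⟶ (α ⟶ γ ⟶ δ) ⟶ (β ⟶ γ) ⟶ ε ⟶ δ)
                                  (⋀ 𝕋 χ χs ∷ ⋀ 𝕋 χ′ χs′ ∷ φ ∷ ψ ∷ ⋀ 𝕋 χ (χs ++ χ′ ∷ χs′) ∷ []))
                       (⋀-++ χ χs χ′ χs′)) t) u)

    ⊩→Derives : ∀ {Γ φ} → Γ ⊩ φ → Derives 𝕋 X Γ φ
    ⊩→Derives {φ = φ} (hyp g) = inj₂ (φ , [] , g ∷ [] , tautology (α ⟶ α) (φ ∷ []))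
    ⊩→Derives (thm t)         = inj₁ t
    ⊩→Derives (mp d e)        = Derives-mp (⊩→Derives d) (⊩→Derives e)

  module Canonical (lem : ExcludedMiddle 0ℓ) (X : Sys) where
    open Hilbert X

    ⊕¬-consistent : ∀ {Γ} χ → Consistent Γ → ¬ Consistent (Γ ⊕ χ) → Consistent (Γ ⊕ ¬' χ)
    ⊕¬-consistent χ con ¬con d = ¬con λ d′ →
      con (mp (mp (thm (tautology ((α ⟶ β) ⟶ (~ α ⟶ β) ⟶ β) (χ ∷ ⊥ᶠ ∷ []))) (deduction d′)) (deduction d))

    decide : (Γ : Formula → Set) (χ : Formula) → Dec (Consistent (Γ ⊕ χ)) → Formula
    decide Γ χ (yes _) = χ
    decide Γ χ (no _)  = ¬' χ

    decide-consistent : ∀ {Γ} χ d → Consistent Γ → Consistent (Γ ⊕ decide Γ χ d)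
    decide-consistent χ (yes con) _   = con
    decide-consistent χ (no ¬con) con = ⊕¬-consistent χ con ¬con

    decide-decides : ∀ Γ χ d → (Γ ⊕ decide Γ χ d) χ ⊎ (Γ ⊕ decide Γ χ d) (¬' χ)
    decide-decides Γ χ (yes _) = inj₁ (inj₂ refl)
    decide-decides Γ χ (no _)  = inj₂ (inj₂ refl)

    extend : (Formula → Set) → ℕ → Formula → Set
    extend Γ n with lem {∃ λ χ → code χ ≡ n}
    ... | yes (χ , _) = Γ ⊕ decide Γ χ lem
    ... | no _        = Γ

    extend-⊇ : ∀ Γ n {ψ} → Γ ψ → extend Γ n ψ
    extend-⊇ Γ n g with lem {∃ λ χ → code χ ≡ n}
    ... | yes _ = inj₁ g
    ... | no _  = g

    extend-consistent : ∀ Γ n → Consistent Γ → Consistent (extend Γ n)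
    extend-consistent Γ n con with lem {∃ λ χ → code χ ≡ n}
    ... | yes (χ , _) = decide-consistent χ lem con
    ... | no _        = con

    extend-decides : ∀ Γ ψ → extend Γ (code ψ) ψ ⊎ extend Γ (code ψ) (¬' ψ)
    extend-decides Γ ψ with lem {∃ λ χ → code χ ≡ code ψ}
    ... | no ∄χ = ⊥-elim (∄χ (ψ , refl))
    ... | yes (χ , e) with code-injective χ ψ e
    ...   | refl = decide-decides Γ χ lem

    module Lindenbaum (Γ : Formula → Set) (con : Consistent Γ) where

      stage : ℕ → Formula → Set
      stage zero    = Γ
      stage (suc n) = extend (stage n) n

      stage-consistent : ∀ n → Consistent (stage n)
      stage-consistent zero    = con
      stage-consistent (suc n) = extend-consistent (stage n) n (stage-consistent n)

      stage-mono : ∀ {m n} → m ≤′ n → ∀ {ψ} → stage m ψ → stage n ψ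
      stage-mono ≤′-refl        g = g
      stage-mono (≤′-step m≤′n) g = extend-⊇ _ _ (stage-mono m≤′n g)

      Γ* : Formula → Set
      Γ* ψ = ∃ λ n → stage n ψ

      compact : ∀ {φ} → Γ* ⊩ φ → ∃ λ n → stage n ⊩ φ
      compact (hyp (n , g)) = n , hyp g
      compact (thm t)       = 0 , thm t
      compact (mp d e) with compact d | compact e
      ... | m , d′ | n , e′ =
        m ⊔ n , mp (⊩-mono (stage-mono (≤⇒≤′ (m≤m⊔n m n))) d′) (⊩-mono (stage-mono (≤⇒≤′ (m≤n⊔m m n))) e′)

      Γ*-consistent : Consistent Γ*
      Γ*-consistent d with compact d
      ... | n , d′ = stage-consistent n d′

      Γ*-complete : ∀ ψ → Γ* ψ ⊎ Γ* (¬' ψ)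
      Γ*-complete ψ = Sum.map (suc (code ψ) ,_) (suc (code ψ) ,_) (extend-decides (stage (code ψ)) ψ)

    -- Worlds are Boolean-valued so that they form a type in Set, as the carrier of a Model must.
    record World : Set where
      field
        mem        : Formula → Bool
        consistent : Consistent (λ φ → True (mem φ))
        complete   : ∀ φ → True (mem φ) ⊎ True (mem (¬' φ))
    open World

    infix 4 _∋_
    _∋_ : World → Formula → Set
    w ∋ φ = True (mem w φ)

    lindenbaum : ∀ {Γ} → Consistent Γ → Σ World λ w → ∀ {φ} → Γ φ → w ∋ φ
    lindenbaum {Γ} con = w , λ g → fromWitness (0 , g)
      where
      open Lindenbaum Γ con
      w : World
      w .mem φ        = isYes (lem {Γ* φ})
      w .consistent d = Γ*-consistent (⊩-mono toWitness d)
      w .complete φ   = Sum.map fromWitness fromWitness (Γ*-complete φ)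

    module _ (w : World) where

      ∋-closed : ∀ {φ} → (w ∋_) ⊩ φ → w ∋ φ
      ∋-closed {φ} d with complete w φ
      ... | inj₁ g  = g
      ... | inj₂ ng = ⊥-elim (consistent w (mp (mp (thm (tautology (~ α ⟶ α ⟶ β) (φ ∷ ⊥ᶠ ∷ []))) (hyp ng)) d))

      ∋-thm : ∀ {φ} → ⊢ φ → w ∋ φ
      ∋-thm t = ∋-closed (thm t)

      ∋-mp : ∀ {φ ψ} → w ∋ φ ⇒ ψ → w ∋ φ → w ∋ ψ
      ∋-mp g h = ∋-closed (mp (hyp g) (hyp h))

      ∋-¬ : ∀ {φ} → w ∋ ¬' φ ⇔ (¬ w ∋ φ)
      ∋-¬ {φ} = mk⇔
        (λ ng g → consistent w (mp (mp (thm (tautology (α ⟶ ~ α ⟶ ~ (β ⟶ β)) (φ ∷ var 0 ∷ []))) (hyp g)) (hyp ng)))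
        (λ ¬g → Sum.[ (λ g → ⊥-elim (¬g g)) , id ] (complete w φ))

      ∋-stable : ∀ {φ} → ¬ ¬ w ∋ φ → w ∋ φ
      ∋-stable {φ} ¬¬g = Sum.[ id , (λ ng → ⊥-elim (¬¬g (Equivalence.to ∋-¬ ng))) ] (complete w φ)

      ∋-⇒ : ∀ {φ ψ} → w ∋ φ ⇒ ψ ⇔ (w ∋ φ → w ∋ ψ)
      ∋-⇒ {φ} {ψ} = mk⇔ ∋-mp λ f → Sum.[
        (λ g → ∋-mp (∋-thm (tautology (β ⟶ α ⟶ β) (φ ∷ ψ ∷ []))) (f g)) ,
        (λ ng → ∋-mp (∋-thm (tautology (~ α ⟶ α ⟶ β) (φ ∷ ψ ∷ []))) ng) ] (complete w φ)

      ∋-□ : ∀ {i φ} → w ∋ □ i φ ⇔ w ∋ [∩ ⟨ i ⟩ ] φ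
      ∋-□ {i} {φ} = mk⇔
        (∋-mp (∋-mp (∋-thm (tautology ((α ⟶ β) & (β ⟶ α) ⟶ α ⟶ β) (□ i φ ∷ [∩ ⟨ i ⟩ ] φ ∷ []))) (∋-thm ax∩1)))
        (∋-mp (∋-mp (∋-thm (tautology ((α ⟶ β) & (β ⟶ α) ⟶ β ⟶ α) (□ i φ ∷ [∩ ⟨ i ⟩ ] φ ∷ []))) (∋-thm ax∩1)))

      ∋-[∩]-closed : ∀ {I φ} → (λ ψ → w ∋ [∩ I ] ψ) ⊩ φ → w ∋ [∩ I ] φ
      ∋-[∩]-closed (hyp g)  = g
      ∋-[∩]-closed (thm t)  = ∋-thm (nec∩ t)
      ∋-[∩]-closed (mp d e) = ∋-mp (∋-mp (∋-thm axK∩) (∋-[∩]-closed d)) (∋-[∩]-closed e)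

    record Rᶜ (I : Index 𝕋) (w u : World) : Set where
      constructor rᶜ
      field unbox : ∀ {φ} → w ∋ [∩ I ] φ → u ∋ φ
    open Rᶜ

    Rᶜ-antitone : ∀ {I J w u} → _⊆ᴵ_ 𝕋 I J → Rᶜ J w u → Rᶜ I w u
    Rᶜ-antitone {w = w} I⊆J r = rᶜ λ g → unbox r (∋-mp w (∋-thm w (ax∩2 I⊆J)) g)

    existence : ∀ {w I φ} → ¬ w ∋ [∩ I ] φ → Σ World λ u → Rᶜ I w u × ¬ u ∋ φ
    existence {w} {I} {φ} ∌□φ
      with lindenbaum {(λ ψ → w ∋ [∩ I ] ψ) ⊕ ¬' φ} (∌□φ ∘ ∋-[∩]-closed w ∘ by-contradiction)
    ... | u , ⊇ = u , rᶜ (⊇ ∘ inj₁) , Equivalence.to (∋-¬ u) (⊇ (inj₂ refl))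

    Rᶜ-reflexive : (∀ {I φ} → ⊢ [∩ I ] φ ⇒ φ) → ∀ {I} → Reflexive (Rᶜ I)
    Rᶜ-reflexive ax {x = w} = rᶜ (∋-mp w (∋-thm w ax))

    Rᶜ-symmetric : (∀ {I φ} → ⊢ ¬' φ ⇒ [∩ I ] (¬' ([∩ I ] φ))) → ∀ {I} → Symmetric (Rᶜ I)
    Rᶜ-symmetric ax {x = w} {y = u} r = rᶜ λ g → ∋-stable w λ ∌φ →
      Equivalence.to (∋-¬ u) (unbox r (∋-mp w (∋-thm w ax) (Equivalence.from (∋-¬ w) ∌φ))) g

    Rᶜ-transitive : (∀ {I φ} → ⊢ [∩ I ] φ ⇒ [∩ I ] ([∩ I ] φ)) → ∀ {I} → Transitive (Rᶜ I)
    Rᶜ-transitive ax {i = w} r r′ = rᶜ λ g → unbox r′ (unbox r (∋-mp w (∋-thm w ax) g))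

    Rᶜ-euclidean : (∀ {I φ} → ⊢ ¬' ([∩ I ] φ) ⇒ [∩ I ] (¬' ([∩ I ] φ))) → ∀ {I} → Euclidean (Rᶜ I)
    Rᶜ-euclidean ax {x = w} {y = u} r r′ = rᶜ λ g → unbox r′ (∋-stable w λ ∌□φ →
      Equivalence.to (∋-¬ u) (unbox r (∋-mp w (∋-thm w ax) (Equivalence.from (∋-¬ w) ∌□φ))) g)

    Rᶜ-serial : (∀ {i φ} → ⊢ □ i φ ⇒ ¬' (□ i (¬' φ))) → ∀ i → Serial (Rᶜ ⟨ i ⟩)
    Rᶜ-serial ax i w = let (u , r , _) = existence {w} {⟨ i ⟩} {⊥ᶠ} ∌□⊥ in u , r
      where
      ∌□⊥ : ¬ w ∋ [∩ ⟨ i ⟩ ] ⊥ᶠ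
      ∌□⊥ g = Equivalence.to (∋-¬ w) (∋-mp w (∋-thm w ax) (∋-thm w (nec (tautology (α ⟶ α) (var 0 ∷ [])))))
                                      (Equivalence.from (∋-□ w) g)

    module Unravelling (root : World) where

      Step : Set
      Step = Index 𝕋 × World

      tip : List Step → World
      tip []            = root
      tip ((_ , u) ∷ _) = u

      Valid : List Step → Set
      Valid []            = ⊤
      Valid ((J , u) ∷ π) = Valid π × Rᶜ J (tip π) u

      State : Set
      State = Σ (List Step) Valid

      world : State → World
      world (π , _) = tip π

      Labelled : Ty → Step → Set
      Labelled i x = _∈ᴵ_ 𝕋 i (proj₁ x)

      Covers : Index 𝕋 → Step → Set
      Covers I x = _⊆ᴵ_ 𝕋 I (proj₁ x)

      model : Model 𝕋
      model = record
        { S  = State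
        ; s₀ = [] , tt
        ; R  = λ i s t → Joined X (Labelled i) (proj₁ s) (proj₁ t)
        ; V  = λ p s → world s ∋ var p
        }

      child : (s : State) {I : Index 𝕋} {u : World} → Rᶜ I (world s) u → State
      child (π , v) {I} {u} r = (I , u) ∷ π , v , r

      child-Rᴵ : ∀ s {I u} (r : Rᶜ I (world s) u) → Rᴵ 𝕋 model I s (child s r)
      child-Rᴵ (π , _) r i i∈I = Joined-step π i∈I

      Rᴵ⇒Joined : ∀ {I s t} → Rᴵ 𝕋 model I s t → Joined X (Covers I) (proj₁ s) (proj₁ t)
      Rᴵ⇒Joined {index i is _} r = Joined-map (λ all j j∈I → All.lookup all j∈I) (Joined-⋂ Labelled i is r)

      step-Rᶜ : ∀ {I} x π → Valid (x ∷ π) → Covers I x → Rᶜ I (tip π) (tip (x ∷ π))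
      step-Rᶜ (J , u) π (_ , r) I⊆J = Rᶜ-antitone I⊆J r

      climb : ∀ {I} → Reflexive (Rᶜ I) → Transitive (Rᶜ I) →
              ∀ b π → Valid (b ++ π) → All (Covers I) b → Rᶜ I (tip π) (tip (b ++ π))
      climb rfl trn []      π _ []       = rfl
      climb rfl trn (x ∷ b) π v (c ∷ cs) = trn (climb rfl trn b π (proj₁ v) cs) (step-Rᶜ x (b ++ π) v c)

      Joined⇒Rᶜ : ∀ Y {I} → ClosureCond Y (Rᶜ I) → ∀ {π π′} → Valid π → Valid π′ →
                  Joined Y (Covers I) π π′ → Rᶜ I (tip π) (tip π′)
      Joined⇒Rᶜ K  _ _ v′ (joined [] (x ∷ []) π refl refl [] (c ∷ []) (refl , _)) = step-Rᶜ x π v′ c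
      Joined⇒Rᶜ D  _ _ v′ (joined [] (x ∷ []) π refl refl [] (c ∷ []) (refl , _)) = step-Rᶜ x π v′ c
      Joined⇒Rᶜ T  rfl _ _ (joined [] [] π refl refl [] [] (refl , _))            = rfl
      Joined⇒Rᶜ T  _ _ v′ (joined [] (x ∷ []) π refl refl [] (c ∷ []) (refl , _)) = step-Rᶜ x π v′ c
      Joined⇒Rᶜ B  (rfl , _) _ _ (joined [] [] π refl refl [] [] _)               = rfl
      Joined⇒Rᶜ B  _ _ v′ (joined [] (x ∷ []) π refl refl [] (c ∷ []) (inj₁ (refl , _))) = step-Rᶜ x π v′ c
      Joined⇒Rᶜ B  (_ , sym) v _ (joined (x ∷ []) [] π refl refl (c ∷ []) [] (inj₂ (_ , refl))) =
        sym (step-Rᶜ x π v c)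
      Joined⇒Rᶜ S4 (rfl , trn) _ v′ (joined [] b π refl refl [] cs refl) = climb rfl trn b π v′ cs
      Joined⇒Rᶜ S5 (rfl , sym , trn) v v′ (joined a b π refl refl ca cb _) =
        trn (sym (climb rfl trn a π v ca)) (climb rfl trn b π v′ cb)

      module Truth (closure : ∀ I → ClosureCond X (Rᶜ I)) where
        open Equivalence using (to; from)

        infix 4 _⊨ᵘ_
        _⊨ᵘ_ : State → Formula → Set
        _⊨ᵘ_ = _⊨_ 𝕋 model

        truth-[∩] : ∀ {I φ} → (∀ t → t ⊨ᵘ φ ⇔ world t ∋ φ) → ∀ s → s ⊨ᵘ [∩ I ] φ ⇔ world s ∋ [∩ I ] φ
        truth-[∩] {I} {φ} ih s = mk⇔
          (λ h → ∋-stable (world s) λ ∌□φ → let (u , r , ∌φ) = existence {world s} {I} {φ} ∌□φ in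
            ∌φ (to (ih (child s r)) (h (child s r) (child-Rᴵ s r))))
          (λ g t r → from (ih t) (unbox (Joined⇒Rᶜ X (closure I) (proj₂ s) (proj₂ t) (Rᴵ⇒Joined {I} {s} {t} r)) g))

        truth : ∀ φ s → s ⊨ᵘ φ ⇔ world s ∋ φ
        truth (var p)    s = mk⇔ id id
        truth (¬' φ)     s = mk⇔
          (λ ¬h → from (∋-¬ (world s)) (¬h ∘ from (truth φ s)))
          (λ ng → to (∋-¬ (world s)) ng ∘ to (truth φ s))
        truth (φ ⇒ ψ)    s = mk⇔
          (λ f → from (∋-⇒ (world s)) (to (truth ψ s) ∘ f ∘ from (truth φ s)))
          (λ g → from (truth ψ s) ∘ to (∋-⇒ (world s)) g ∘ to (truth φ s))
        truth (□ i φ)    s =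
          ⇔-trans (⊨-□ model {s} {i} {φ}) (⇔-trans (truth-[∩] {⟨ i ⟩} (truth φ) s) (⇔-sym (∋-□ (world s))))
        truth ([∩ I ] φ) s = truth-[∩] (truth φ) s

  canonical-closure : (lem : ExcludedMiddle 0ℓ) (X : Sys) → ∀ I → ClosureCond X (Canonical.Rᶜ lem X I)
  canonical-closure lem K  I = tt
  canonical-closure lem D  I = tt
  canonical-closure lem T  I = Rᶜ-reflexive (extra (axT∩ tt))
    where open Canonical lem T
  canonical-closure lem B  I = Rᶜ-reflexive (extra (axT∩ tt)) , Rᶜ-symmetric (extra axB∩)
    where open Canonical lem B
  canonical-closure lem S4 I = Rᶜ-reflexive (extra (axT∩ tt)) , Rᶜ-transitive (extra ax4∩)
    where open Canonical lem S4
  canonical-closure lem S5 I =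
    reflexive ,
    euclidean⇒symmetric {r = Rᶜ I} reflexive euclidean ,
    euclidean⇒transitive {r = Rᶜ I} reflexive euclidean
    where
    open Canonical lem S5
    reflexive : Reflexive (Rᶜ I)
    reflexive = Rᶜ-reflexive (extra (axT∩ tt))
    euclidean : Euclidean (Rᶜ I)
    euclidean = Rᶜ-euclidean (extra ax5∩)

  unravelled-inClass : (lem : ExcludedMiddle 0ℓ) (X : Sys) (root : Canonical.World lem X) →
                       InClass 𝕋 X (Canonical.Unravelling.model lem X root)
  unravelled-inClass lem K  root i = tt
  unravelled-inClass lem D  root i s =
    let (u , r) = Rᶜ-serial (extra axD) i (world s) in child s r , Joined-step (proj₁ s) (here refl)
    where
    open Canonical lem D
    open Unravelling root
  unravelled-inClass lem T  root i = Joined-refl (refl , _)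
  unravelled-inClass lem B  root i = Joined-refl (inj₁ (refl , _)) , Joined-swap Shape-swap-B
  unravelled-inClass lem S4 root i = Joined-refl refl , Joined-trans-S4
  unravelled-inClass lem S5 root i = Joined-refl _ , Joined-swap _ , Joined-trans-S5

  satisfiable : (lem : ExcludedMiddle 0ℓ) (X : Sys) {Γ : Formula → Set} → Hilbert.Consistent X Γ →
                Σ (Model 𝕋) λ M → InClass 𝕋 X M × Σ (Model.S M) λ s → ∀ ψ → Γ ψ → _⊨_ 𝕋 M s ψ
  satisfiable lem X {Γ} con =
    model , unravelled-inClass lem X root , ([] , tt) , λ ψ g → Equivalence.from (truth ψ ([] , tt)) (Γ⊆root g)
    where
    open Canonical lem X
    root : World
    root = proj₁ (lindenbaum con)
    Γ⊆root : ∀ {φ} → Γ φ → root ∋ φ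
    Γ⊆root = proj₂ (lindenbaum con)
    open Unravelling root
    open Truth (canonical-closure lem X)

theorem1 : ExcludedMiddle 0ℓ →
    (𝕋 : PrimTypes) (X : Sys) (Φ : Fm 𝕋 → Set) (φ : Fm 𝕋) →
    SemConseq 𝕋 X Φ φ → Derives 𝕋 X Φ φ
theorem1 lem 𝕋 X Φ φ Φ⊨φ = decidable-stable lem λ Φ⊬φ →
  let (M , M∈X , s , s⊨Φ,¬φ) = satisfiable lem X (Φ⊬φ ∘ ⊩→Derives ∘ by-contradiction)
  in s⊨Φ,¬φ (¬' φ) (inj₂ refl) (Φ⊨φ M M∈X s λ ψ → s⊨Φ,¬φ ψ ∘ inj₁)
  where
  open Completeness 𝕋
  open Hilbert X
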